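{- Let $S\subset\mathbb{F}_2^n$ with $\mathbf{0}\in S$ and such that $S\setminus\{\mathbf{0}\}$ is a linearly independent set with $r$ elements. If $\#S$ is even and $r$ is odd, then $$\#B(S)=\binom{r}{(r+1)/2}\,2^{n-r}.$$ If $r$ is even, then $B(S)=\emptyset$ and $b(S)=0$.
   Context: For $\mathbf{x},\mathbf{y}\in\mathbb{F}_2^n$ the pairing is $\mathbf{x}\cdot\mathbf{y}=\sum_{i=1}^n x_iy_i\in\mathbb{F}_2$, and $H_{\mathbf{y}}=\{\mathbf{x}\in\mathbb{F}_2^n\mid \mathbf{x}\cdot\mathbf{y}=0\}$. For a nonzero $\mathbf{y}$, a set $S$ is $\mathbf{y}$-balanced if $\#(S\cap H_{\mathbf{y}})=\#S/2$. $S$ is $\mathbf{y}$-constant if $S\subset H_{\mathbf{y}}$ or $S\cap H_{\mathbf{y}}=\emptyset$. The balancing set $B(S)$ is the set of nonzero $\mathbf{y}$ such that $S$ is $\mathbf{y}$-balanced; the constant set $C(S)$ is the set of $\mathbf{y}\in\mathbb{F}_2^n$ such that $S$ is $\mathbf{y}$-constant. The balancing number is $b(S)=\#B(S)/\#C(S)$. -}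

module Defs where

open import Data.Bool using (Bool; true; false; _∧_; _∨_; not; _xor_; if_then_else_)
open import Data.Nat using (ℕ; zero; suc; _+_; _*_; _≡ᵇ_)
open import Data.Fin using (Fin; zero; suc)
open import Data.Vec using (Vec; []; _∷_; replicate; zipWith)
open import Data.List using (List; []; _∷_; _++_; map)
open import Data.Rational using (ℚ; 0ℚ; _/_)
open import Data.Integer using (+_)

-- Vectors of 𝔽₂ⁿ, with 𝔽₂ = Bool (false = 0, true = 1, addition = xor, product = ∧).
F2 : ℕ → Set
F2 n = Vec Bool n

zeroV : ∀ {n} → F2 n
zeroV = replicate _ false

_+V_ : ∀ {n} → F2 n → F2 n → F2 n
_+V_ = zipWith _xor_

isZeroV : ∀ {n} → F2 n → Bool
isZeroV [] = true
isZeroV (b ∷ x) = not b ∧ isZeroV x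

dot : ∀ {n} → F2 n → F2 n → Bool
dot [] [] = false
dot (a ∷ x) (b ∷ y) = (a ∧ b) xor dot x y

allVecs : ∀ n → List (F2 n)
allVecs zero = [] ∷ []
allVecs (suc n) = map (false ∷_) (allVecs n) ++ map (true ∷_) (allVecs n)

countB : ∀ {A : Set} → (A → Bool) → List A → ℕ
countB p [] = 0
countB p (x ∷ xs) = if p x then suc (countB p xs) else countB p xs

linComb : ∀ {n} r → (Fin r → Bool) → (Fin r → F2 n) → F2 n
linComb zero c v = zeroV
linComb (suc r) c v =
  (if c zero then v zero else zeroV) +V linComb r (λ i → c (suc i)) (λ i → v (suc i))

LinIndep : ∀ {n r} → (Fin r → F2 n) → Set
LinIndep {n} {r} v = ∀ (c : Fin r → Bool) → linComb r c v ≡ zeroV → ∀ i → c i ≡ false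
  where open import Relation.Binary.PropositionalEquality using (_≡_)

Subset : ℕ → Set
Subset n = F2 n → Bool

card : ∀ {n} → Subset n → ℕ
card {n} S = countB S (allVecs n)

cardH : ∀ {n} → Subset n → F2 n → ℕ
cardH {n} S y = countB (λ x → S x ∧ not (dot x y)) (allVecs n)

isBalanced : ∀ {n} → Subset n → F2 n → Bool
isBalanced S y = (2 * cardH S y) ≡ᵇ card S

isConstant : ∀ {n} → Subset n → F2 n → Bool
isConstant S y = (cardH S y ≡ᵇ card S) ∨ (cardH S y ≡ᵇ 0)

cardB : ∀ {n} → Subset n → ℕ
cardB {n} S = countB (λ y → not (isZeroV y) ∧ isBalanced S y) (allVecs n)

cardC : ∀ {n} → Subset n → ℕ
cardC {n} S = countB (isConstant S) (allVecs n)

-- balancing number b(S) = #B(S) / #C(S)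
-- (#C(S) ≥ 1 always since y = 0 is constant; the zero branch is unreachable)
balancingNumber : ∀ {n} → Subset n → ℚ
balancingNumber S with cardC S
... | zero = 0ℚ
... | suc k = (+ cardB S) / suc k

-- Write S = {0, v₁, …, v_r} and let w(y) = #{i | vᵢ · y = 1}. Then #(S ∩ H_y) = #S − w(y), so S
-- is y-balanced iff 2 (r + 1 − w(y)) = r + 1: impossible when r is even, and equivalent to
-- w(y) = (r + 1)/2 when r is odd (which also rules out y = 0). Independence of the vᵢ gives
-- #{y | w(y) = k} · 2^r = C(r,k) · 2^n, by induction on r: if u lies outside the span of
-- v₁, …, v_r, then y ↦ u · y takes the values 0 and 1 equally often on every level set of w.
-- That equidistribution is itself proved by induction, applying the hypothesis for v₂, …, v_r
-- to both u and u + v₁.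
module Submission where

open import Defs
open import Algebra.Bundles using (CommutativeRing)
import Data.Bool.Properties as Bool
open import Algebra.Properties.CommutativeSemigroup
  (CommutativeRing.+-commutativeSemigroup Bool.xor-∧-commutativeRing) using (interchange)
open import Data.Bool using (Bool; true; false; _∧_; _∨_; not; _xor_; if_then_else_)
open import Data.Fin using (Fin; zero; suc)
import Data.Fin.Properties as Fin
open import Data.List using (List; []; _∷_; _++_; map; tabulate; length)
open import Data.List.Properties using (length-tabulate)
import Data.List.Membership.DecPropositional as DecMembership
open import Data.List.Membership.Propositional using (_∈_)
open import Data.List.Membership.Propositional.Properties using (∈-tabulate⁺; ∈-tabulate⁻)
import Data.List.Relation.Unary.All.Properties as All
open import Data.List.Relation.Unary.AllPairs using (_∷_)
open import Data.List.Relation.Unary.Any using (here; there)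
open import Data.List.Relation.Unary.Unique.Propositional using (Unique)
import Data.List.Relation.Unary.Unique.Propositional.Properties as Unique
open import Data.Nat using (ℕ; zero; suc; _+_; _*_; _^_; _∸_; _/_; _≤_; _≡ᵇ_)
open import Data.Nat.Combinatorics using (_C_; nCk+nC[k+1]≡[n+1]C[k+1])
open import Data.Nat.Divisibility using (_∣_; divides; ∣m+n∣m⇒∣n; ∣1⇒≡1; m∣m*n)
open import Data.Nat.DivMod using (m*n/n≡m)
open import Data.Nat.Logarithm using (⌊log₂⌋-mono-≤; ⌊log₂[2^n]⌋≡n)
open import Data.Nat.Properties
  using ( +-comm; +-suc; +-identityʳ; +-cancelˡ-≡; +-cancelʳ-≡; 1+n≢0; m≤m+n
        ; *-comm; *-assoc; *-identityˡ; *-identityʳ; *-distribˡ-+; *-distribʳ-+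
        ; *-cancelˡ-≡; *-cancelʳ-≡; *-monoˡ-≤; m^n≢0; ^-distribˡ-+-*; m+[n∸m]≡n
        ; module ≤-Reasoning )
  renaming (_≟_ to _≟ℕ_)
open import Data.Nat.Solver using (module +-*-Solver)
open +-*-Solver using (solve; _:+_; _:*_; _:=_; con)
open import Data.Product using (_×_; _,_; ∃; proj₁; proj₂)
open import Data.Rational using (0ℚ)
open import Data.Rational.Properties using (0/n≡0)
open import Data.Sum using (_⊎_; inj₁; inj₂)
open import Data.Vec using ([]; _∷_)
open import Data.Vec.Functional using (tail) renaming (_∷_ to _◂_)
open import Data.Vec.Properties using (≡-dec; zipWith-assoc; zipWith-comm; zipWith-identityˡ; zipWith-identityʳ)
open import Function using (_∘_)
open import Function.Bundles using (_⇔_; mk⇔)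
import Function.Properties.Equivalence as ⇔
open import Relation.Binary.Definitions using (DecidableEquality)
open import Relation.Binary.PropositionalEquality
open import Relation.Nullary using (¬_; yes; no; does; contradiction)
open import Relation.Nullary.Decidable using (does-⇔; dec-false; T?)

-- The vector space 𝔽₂ⁿ

_≟_ : ∀ {n} → DecidableEquality (F2 n)
_≟_ = ≡-dec Bool._≟_

module _ {n : ℕ} where
  open DecMembership (_≟_ {n}) public using (_∈?_)

+V-assoc : ∀ {n} (x y z : F2 n) → (x +V y) +V z ≡ x +V (y +V z)
+V-assoc = zipWith-assoc Bool.xor-assoc

+V-comm : ∀ {n} (x y : F2 n) → x +V y ≡ y +V x
+V-comm = zipWith-comm Bool.xor-comm

+V-identityˡ : ∀ {n} (x : F2 n) → zeroV +V x ≡ x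
+V-identityˡ = zipWith-identityˡ Bool.xor-identityˡ

+V-identityʳ : ∀ {n} (x : F2 n) → x +V zeroV ≡ x
+V-identityʳ = zipWith-identityʳ Bool.xor-identityʳ

+V-self : ∀ {n} (x : F2 n) → x +V x ≡ zeroV
+V-self []      = refl
+V-self (a ∷ x) = cong₂ _∷_ (Bool.xor-same a) (+V-self x)

dot-zeroˡ : ∀ {n} (y : F2 n) → dot zeroV y ≡ false
dot-zeroˡ []      = refl
dot-zeroˡ (b ∷ y) = dot-zeroˡ y

dot-zeroʳ : ∀ {n} (x : F2 n) → dot x zeroV ≡ false
dot-zeroʳ []      = refl
dot-zeroʳ (a ∷ x) = trans (cong (_xor dot x zeroV) (Bool.∧-zeroʳ a)) (dot-zeroʳ x)

dot-distribˡ-+V : ∀ {n} (u w y : F2 n) → dot (u +V w) y ≡ dot u y xor dot w y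
dot-distribˡ-+V []      []      []      = refl
dot-distribˡ-+V (a ∷ u) (b ∷ w) (c ∷ y) =
  trans (cong₂ _xor_ (Bool.∧-distribʳ-xor c a b) (dot-distribˡ-+V u w y))
        (interchange (a ∧ c) (b ∧ c) (dot u y) (dot w y))

isZeroV-sound : ∀ {n} {y : F2 n} → isZeroV y ≡ true → y ≡ zeroV
isZeroV-sound {y = []}        _ = refl
isZeroV-sound {y = false ∷ y} e = cong (false ∷_) (isZeroV-sound e)

-- Spans and linear independence

_∈Span_ : ∀ {n r} → F2 n → (Fin r → F2 n) → Set
_∈Span_ {r = r} u v = ∃ λ c → linComb r c v ≡ u

δ : ∀ {r} → Fin r → Fin r → Bool
δ i j = does (i Fin.≟ j)

linComb-zero : ∀ {n} r (v : Fin r → F2 n) → linComb r (λ _ → false) v ≡ zeroV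
linComb-zero zero    v = refl
linComb-zero (suc r) v = trans (+V-identityˡ _) (linComb-zero r (tail v))

linComb-δ : ∀ {n r} (i : Fin r) (v : Fin r → F2 n) → linComb r (δ i) v ≡ v i
linComb-δ {r = suc r} zero    v = trans (cong (v zero +V_) (linComb-zero r (tail v))) (+V-identityʳ (v zero))
linComb-δ {r = suc r} (suc i) v = trans (+V-identityˡ _) (linComb-δ i (tail v))

∉Span-tail : ∀ {n r} (v : Fin (suc r) → F2 n) {u} → ¬ u ∈Span v → ¬ u ∈Span tail v
∉Span-tail v u∉ (c , e) = u∉ (false ◂ c , trans (+V-identityˡ _) e)

∉Span-tail-+V-head : ∀ {n r} (v : Fin (suc r) → F2 n) {u} → ¬ u ∈Span v → ¬ (u +V v zero) ∈Span tail v
∉Span-tail-+V-head {r = r} v {u} u∉ (c , e) = u∉ (true ◂ c , (begin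
  v zero +V linComb r c (tail v) ≡⟨ cong (v zero +V_) e ⟩
  v zero +V (u +V v zero)        ≡⟨ cong (v zero +V_) (+V-comm u (v zero)) ⟩
  v zero +V (v zero +V u)        ≡⟨ +V-assoc (v zero) (v zero) u ⟨
  (v zero +V v zero) +V u        ≡⟨ cong (_+V u) (+V-self (v zero)) ⟩
  zeroV +V u                     ≡⟨ +V-identityˡ u ⟩
  u                              ∎))
  where open ≡-Reasoning

LinIndep-tail : ∀ {n r} (v : Fin (suc r) → F2 n) → LinIndep v → LinIndep (tail v)
LinIndep-tail v li c e i = li (false ◂ c) (trans (+V-identityˡ _) e) (suc i)

head∉Span-tail : ∀ {n r} (v : Fin (suc r) → F2 n) → LinIndep v → ¬ v zero ∈Span tail v
head∉Span-tail v li (c , e) with li (true ◂ c) (trans (cong (v zero +V_) e) (+V-self (v zero))) zero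
... | ()

LinIndep⇒nonzero : ∀ {n r} (v : Fin r → F2 n) → LinIndep v → ∀ i → v i ≢ zeroV
LinIndep⇒nonzero {r = suc r} v li zero e =
  head∉Span-tail v li ((λ _ → false) , trans (linComb-zero r (tail v)) (sym e))
LinIndep⇒nonzero v li (suc i) = LinIndep⇒nonzero (tail v) (LinIndep-tail v li) i

LinIndep⇒injective : ∀ {n r} (v : Fin r → F2 n) → LinIndep v → ∀ {i j} → v i ≡ v j → i ≡ j
LinIndep⇒injective v li {zero}  {zero}  e = refl
LinIndep⇒injective v li {zero}  {suc j} e =
  contradiction (δ j , trans (linComb-δ j (tail v)) (sym e)) (head∉Span-tail v li)
LinIndep⇒injective v li {suc i} {zero}  e =
  contradiction (δ i , trans (linComb-δ i (tail v)) e) (head∉Span-tail v li)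
LinIndep⇒injective v li {suc i} {suc j} e = cong suc (LinIndep⇒injective (tail v) (LinIndep-tail v li) e)

-- Counting

countB-cong : ∀ {A : Set} {p q : A → Bool} (xs : List A) → (∀ x → p x ≡ q x) → countB p xs ≡ countB q xs
countB-cong []       _   = refl
countB-cong {q = q} (x ∷ xs) p≗q rewrite p≗q x with q x
... | true  = cong suc (countB-cong xs p≗q)
... | false = countB-cong xs p≗q

countB-empty : ∀ {A : Set} {p : A → Bool} (xs : List A) → (∀ x → p x ≡ false) → countB p xs ≡ 0
countB-empty []       _       = refl
countB-empty (x ∷ xs) p≗false rewrite p≗false x = countB-empty xs p≗false

countB-full : ∀ {A : Set} (xs : List A) → countB (λ _ → true) xs ≡ length xs
countB-full []       = refl
countB-full (x ∷ xs) = cong suc (countB-full xs)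

countB-++ : ∀ {A : Set} (p : A → Bool) (xs ys : List A) → countB p (xs ++ ys) ≡ countB p xs + countB p ys
countB-++ p []       ys = refl
countB-++ p (x ∷ xs) ys with p x
... | true  = cong suc (countB-++ p xs ys)
... | false = countB-++ p xs ys

countB-map : ∀ {A B : Set} (p : B → Bool) (f : A → B) (xs : List A) → countB p (map f xs) ≡ countB (p ∘ f) xs
countB-map p f []       = refl
countB-map p f (x ∷ xs) with p (f x)
... | true  = cong suc (countB-map p f xs)
... | false = countB-map p f xs

countB-split : ∀ {A : Set} (p g : A → Bool) (xs : List A) →
  countB p xs ≡ countB (λ x → p x ∧ g x) xs + countB (λ x → p x ∧ not (g x)) xs
countB-split p g []       = refl
countB-split p g (x ∷ xs) with p x | g x
... | true  | true  = cong suc (countB-split p g xs)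
... | true  | false = trans (cong suc (countB-split p g xs)) (sym (+-suc _ _))
... | false | _     = countB-split p g xs

card-cong : ∀ {n} {p q : Subset n} → (∀ x → p x ≡ q x) → card p ≡ card q
card-cong {n} = countB-cong (allVecs n)

card-empty : ∀ {n} {p : Subset n} → (∀ x → p x ≡ false) → card p ≡ 0
card-empty {n} = countB-empty (allVecs n)

card-split : ∀ {n} (p g : Subset n) → card p ≡ card (λ x → p x ∧ g x) + card (λ x → p x ∧ not (g x))
card-split {n} p g = countB-split p g (allVecs n)

card-cons : ∀ {n} (p : Subset (suc n)) → card p ≡ card (p ∘ (false ∷_)) + card (p ∘ (true ∷_))
card-cons {n} p = trans (countB-++ p (map (false ∷_) (allVecs n)) (map (true ∷_) (allVecs n)))
  (cong₂ _+_ (countB-map p (false ∷_) (allVecs n)) (countB-map p (true ∷_) (allVecs n)))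

card-full : ∀ n → card {n} (λ _ → true) ≡ 2 ^ n
card-full zero    = refl
card-full (suc n) = trans (card-cons {n} (λ _ → true))
  (trans (cong₂ _+_ (card-full n) (card-full n)) (cong (2 ^ n +_) (sym (+-identityʳ (2 ^ n)))))

card-singleton : ∀ {n} (a : F2 n) → card (λ x → does (x ≟ a)) ≡ 1
card-singleton []                = refl
card-singleton {suc n} (false ∷ a) =
  trans (card-cons (λ x → does (x ≟ (false ∷ a)))) (cong₂ _+_ (card-singleton a) (card-empty {n} (λ _ → refl)))
card-singleton {suc n} (true ∷ a)  =
  trans (card-cons (λ x → does (x ≟ (true ∷ a)))) (cong₂ _+_ (card-empty {n} (λ _ → refl)) (card-singleton a))

card-∧-≟ : ∀ {n} (p : Subset n) (a : F2 n) → card (λ x → p x ∧ does (x ≟ a)) ≡ countB p (a ∷ [])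
card-∧-≟ {n} p a = trans (card-cong pointwise) (constant (p a))
  where
  pointwise : ∀ x → p x ∧ does (x ≟ a) ≡ p a ∧ does (x ≟ a)
  pointwise x with x ≟ a
  ... | yes refl = refl
  ... | no _     = trans (Bool.∧-zeroʳ (p x)) (sym (Bool.∧-zeroʳ (p a)))
  constant : ∀ b → card (λ x → b ∧ does (x ≟ a)) ≡ countB (λ _ → b) (a ∷ [])
  constant true  = card-singleton a
  constant false = card-empty {n} (λ _ → refl)

card-pos : ∀ {n} (p : Subset n) a → p a ≡ true → 1 ≤ card p
card-pos p a pa = begin
  1                                                                       ≡⟨ cong (λ b → if b then 1 else 0) pa ⟨
  countB p (a ∷ [])                                                       ≡⟨ card-∧-≟ p a ⟨
  card (λ x → p x ∧ does (x ≟ a))                                         ≤⟨ m≤m+n _ _ ⟩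
  card (λ x → p x ∧ does (x ≟ a)) + card (λ x → p x ∧ not (does (x ≟ a))) ≡⟨ card-split p _ ⟨
  card p                                                                  ∎
  where open ≤-Reasoning

card-∈ : ∀ {n} (xs : List (F2 n)) → Unique xs → (Q : Subset n) →
  card (λ x → does (x ∈? xs) ∧ Q x) ≡ countB Q xs
card-∈ {n} []       _               Q = card-empty {n} (λ _ → refl)
card-∈     (a ∷ xs) (a∉xs ∷ unique) Q = begin
  card (λ x → (does (x ≟ a) ∨ does (x ∈? xs)) ∧ Q x)
    ≡⟨ card-split _ (λ x → does (x ≟ a)) ⟩
  card (λ x → ((does (x ≟ a) ∨ does (x ∈? xs)) ∧ Q x) ∧ does (x ≟ a))
    + card (λ x → ((does (x ≟ a) ∨ does (x ∈? xs)) ∧ Q x) ∧ not (does (x ≟ a)))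
    ≡⟨ cong₂ _+_ (trans (card-cong at-a) (card-∧-≟ Q a)) (card-cong off-a) ⟩
  countB Q (a ∷ []) + card (λ x → does (x ∈? xs) ∧ Q x)
    ≡⟨ cong (countB Q (a ∷ []) +_) (card-∈ xs unique Q) ⟩
  countB Q (a ∷ []) + countB Q xs
    ≡⟨ countB-++ Q (a ∷ []) xs ⟨
  countB Q (a ∷ xs) ∎
  where
  open ≡-Reasoning
  at-a : ∀ x → ((does (x ≟ a) ∨ does (x ∈? xs)) ∧ Q x) ∧ does (x ≟ a) ≡ Q x ∧ does (x ≟ a)
  at-a x with x ≟ a
  ... | yes refl = refl
  ... | no _     = trans (Bool.∧-zeroʳ _) (sym (Bool.∧-zeroʳ (Q x)))
  off-a : ∀ x → ((does (x ≟ a) ∨ does (x ∈? xs)) ∧ Q x) ∧ not (does (x ≟ a)) ≡ does (x ∈? xs) ∧ Q x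
  off-a x with x ≟ a
  ... | yes refl = trans (Bool.∧-zeroʳ _) (cong (_∧ Q a) (sym (dec-false (a ∈? xs) (All.All¬⇒¬Any a∉xs))))
  ... | no _     = Bool.∧-identityʳ _

dot-balanced : ∀ {n} {u : F2 n} → u ≢ zeroV → card (dot u) ≡ card (λ y → not (dot u y))
dot-balanced {u = []} u≢0 = contradiction refl u≢0
dot-balanced {u = true ∷ u} _ = begin
  card (dot (true ∷ u))                                         ≡⟨ card-cons (dot (true ∷ u)) ⟩
  card (dot u) + card (λ y → not (dot u y))                     ≡⟨ +-comm (card (dot u)) _ ⟩
  card (λ y → not (dot u y)) + card (dot u)                     ≡⟨ cong (card (λ y → not (dot u y)) +_) not-not ⟩
  card (λ y → not (dot u y)) + card (λ y → not (not (dot u y))) ≡⟨ card-cons (λ y → not (dot (true ∷ u) y)) ⟨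
  card (λ y → not (dot (true ∷ u) y))                           ∎
  where
  open ≡-Reasoning
  not-not : card (dot u) ≡ card (λ y → not (not (dot u y)))
  not-not = card-cong (λ y → sym (Bool.not-involutive (dot u y)))
dot-balanced {u = false ∷ u} u≢0 =
  trans (card-cons (dot (false ∷ u))) (trans (cong₂ _+_ ih ih) (sym (card-cons (λ y → not (dot (false ∷ u) y)))))
  where
  ih : card (dot u) ≡ card (λ y → not (dot u y))
  ih = dot-balanced (u≢0 ∘ cong (false ∷_))

lit : Bool → Bool → Bool
lit true  x = x
lit false x = not x

∧-lit-cong : ∀ a {b x y} → (b ≡ a → x ≡ y) → x ∧ lit a b ≡ y ∧ lit a b
∧-lit-cong true  {true}  x≡y = cong (_∧ true) (x≡y refl)
∧-lit-cong false {false} x≡y = cong (_∧ true) (x≡y refl)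
∧-lit-cong true  {false} _   = trans (Bool.∧-zeroʳ _) (sym (Bool.∧-zeroʳ _))
∧-lit-cong false {true}  _   = trans (Bool.∧-zeroʳ _) (sym (Bool.∧-zeroʳ _))

lit-xor : ∀ b x a → lit b (x xor a) ≡ lit (b xor a) x
lit-xor true  x false = Bool.xor-identityʳ x
lit-xor false x false = cong not (Bool.xor-identityʳ x)
lit-xor true  x true  = Bool.xor-comm x true
lit-xor false x true  = trans (cong not (Bool.xor-comm x true)) (Bool.not-involutive x)

card-restrict : ∀ {n} (g : Subset n) a (p q : Subset n) → (∀ y → g y ≡ a → p y ≡ q y) →
  card (λ y → p y ∧ lit a (g y)) ≡ card (λ y → q y ∧ lit a (g y))
card-restrict g a p q p≗q = card-cong (λ y → ∧-lit-cong a (p≗q y))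

card-halves : ∀ {n} (p g : Subset n) → card (λ y → p y ∧ g y) ≡ card (λ y → p y ∧ not (g y)) →
  ∀ a → 2 * card (λ y → p y ∧ lit a (g y)) ≡ card p
card-halves p g balanced true = begin
  P + (P + 0)  ≡⟨ cong (P +_) (+-identityʳ P) ⟩
  P + P        ≡⟨ cong (P +_) balanced ⟩
  P + P̅        ≡⟨ card-split p g ⟨
  card p       ∎
  where
  open ≡-Reasoning
  P = card (λ y → p y ∧ g y)
  P̅ = card (λ y → p y ∧ not (g y))
card-halves p g balanced false = begin
  P̅ + (P̅ + 0)  ≡⟨ cong (P̅ +_) (+-identityʳ P̅) ⟩
  P̅ + P̅        ≡⟨ cong (_+ P̅) balanced ⟨
  P + P̅        ≡⟨ card-split p g ⟨
  card p       ∎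
  where
  open ≡-Reasoning
  P = card (λ y → p y ∧ g y)
  P̅ = card (λ y → p y ∧ not (g y))

+-cross-cancel : ∀ {a b c d} → a + b ≡ c + d → c + b ≡ a + d → a ≡ c × b ≡ d
+-cross-cancel {a} {b} {c} {d} e₁ e₂ = a≡c , b≡d
  where
  b≡d : b ≡ d
  b≡d = *-cancelˡ-≡ b d 2 (+-cancelˡ-≡ (a + c) _ _ (begin
    (a + c) + 2 * b    ≡⟨ solve 4 (λ a b c d → (a :+ c) :+ con 2 :* b := (a :+ b) :+ (c :+ b)) refl a b c d ⟩
    (a + b) + (c + b)  ≡⟨ cong₂ _+_ e₁ e₂ ⟩
    (c + d) + (a + d)  ≡⟨ solve 4 (λ a b c d → (c :+ d) :+ (a :+ d) := (a :+ c) :+ con 2 :* d) refl a b c d ⟩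
    (a + c) + 2 * d    ∎))
    where open ≡-Reasoning
  a≡c : a ≡ c
  a≡c = +-cancelʳ-≡ b a c (trans e₁ (cong (c +_) (sym b≡d)))

-- Level sets of the weight y ↦ #{i | vᵢ · y = 1}

weight : ∀ {n r} → (Fin r → F2 n) → F2 n → ℕ
weight v y = countB (λ x → dot x y) (tabulate v)

level : ∀ {n r} → (Fin r → F2 n) → ℕ → Subset n
level v k y = weight v y ≡ᵇ k

weight-zeroʳ : ∀ {n r} (v : Fin r → F2 n) → weight v zeroV ≡ 0
weight-zeroʳ v = countB-empty (tabulate v) dot-zeroʳ

level-hit : ∀ {n r} (v : Fin (suc r) → F2 n) k y → dot (v zero) y ≡ true → level v (suc k) y ≡ level (tail v) k y
level-hit v k y hit rewrite hit = refl

level-hit-zero : ∀ {n r} (v : Fin (suc r) → F2 n) y → dot (v zero) y ≡ true → level v 0 y ≡ false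
level-hit-zero v y hit rewrite hit = refl

level-miss : ∀ {n r} (v : Fin (suc r) → F2 n) k y → dot (v zero) y ≡ false → level v k y ≡ level (tail v) k y
level-miss v k y miss rewrite miss = refl

BalancedOnLevels : ∀ {n r} → (Fin r → F2 n) → F2 n → Set
BalancedOnLevels v u = ∀ k → card (λ y → level v k y ∧ dot u y) ≡ card (λ y → level v k y ∧ not (dot u y))

module _ {n r} (v : Fin (suc r) → F2 n)
         (balanced-tail : ∀ {w} → ¬ w ∈Span tail v → BalancedOnLevels (tail v) w)
         {u : F2 n} (u∉ : ¬ u ∈Span v) where

  private
    N : ℕ → Bool → Bool → ℕ
    N j a b = card (λ y → (level (tail v) j y ∧ lit b (dot u y)) ∧ lit a (dot (v zero) y))

    via-u : ∀ j → N j true true + N j false true ≡ N j true false + N j false false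
    via-u j = trans (sym (card-split _ (dot (v zero))))
      (trans (balanced-tail (∉Span-tail v u∉) j) (card-split _ (dot (v zero))))

    split-+V-head : ∀ j b → card (λ y → level (tail v) j y ∧ lit b (dot (u +V v zero) y))
                          ≡ N j true (b xor true) + N j false (b xor false)
    split-+V-head j b = trans (card-split _ (dot (v zero)))
      (cong₂ _+_ (card-restrict _ true _ _ (shift true)) (card-restrict _ false _ _ (shift false)))
      where
      shift : ∀ a y → dot (v zero) y ≡ a →
        level (tail v) j y ∧ lit b (dot (u +V v zero) y) ≡ level (tail v) j y ∧ lit (b xor a) (dot u y)
      shift a y v₀·y≡a = cong (level (tail v) j y ∧_) (begin
        lit b (dot (u +V v zero) y)         ≡⟨ cong (lit b) (dot-distribˡ-+V u (v zero) y) ⟩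
        lit b (dot u y xor dot (v zero) y)  ≡⟨ cong (λ c → lit b (dot u y xor c)) v₀·y≡a ⟩
        lit b (dot u y xor a)               ≡⟨ lit-xor b (dot u y) a ⟩
        lit (b xor a) (dot u y)             ∎)
        where open ≡-Reasoning

    via-u+V-head : ∀ j → N j true false + N j false true ≡ N j true true + N j false false
    via-u+V-head j = trans (sym (split-+V-head j true))
      (trans (balanced-tail (∉Span-tail-+V-head v u∉) j) (split-+V-head j false))

    balance : ∀ j a → N j a true ≡ N j a false
    balance j true  = proj₁ (+-cross-cancel (via-u j) (via-u+V-head j))
    balance j false = proj₂ (+-cross-cancel (via-u j) (via-u+V-head j))

    split-level-zero : ∀ b → card (λ y → level v 0 y ∧ lit b (dot u y)) ≡ N 0 false b
    split-level-zero b = trans (card-split _ (dot (v zero))) (cong₂ _+_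
      (trans (card-restrict _ true _ (λ _ → false) (λ y hit → cong (_∧ lit b (dot u y)) (level-hit-zero v y hit)))
             (card-empty {n} (λ _ → refl)))
      (card-restrict _ false _ _ (λ y miss → cong (_∧ lit b (dot u y)) (level-miss v 0 y miss))))

    split-level-suc : ∀ k b → card (λ y → level v (suc k) y ∧ lit b (dot u y)) ≡ N k true b + N (suc k) false b
    split-level-suc k b = trans (card-split _ (dot (v zero))) (cong₂ _+_
      (card-restrict _ true _ _ (λ y hit → cong (_∧ lit b (dot u y)) (level-hit v k y hit)))
      (card-restrict _ false _ _ (λ y miss → cong (_∧ lit b (dot u y)) (level-miss v (suc k) y miss))))

  balancedOnLevels-∷ : BalancedOnLevels v u
  balancedOnLevels-∷ zero =
    trans (split-level-zero true) (trans (balance 0 false) (sym (split-level-zero false)))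
  balancedOnLevels-∷ (suc k) = trans (split-level-suc k true)
    (trans (cong₂ _+_ (balance k true) (balance (suc k) false)) (sym (split-level-suc k false)))

balancedOnLevels : ∀ {n r} (v : Fin r → F2 n) {u} → ¬ u ∈Span v → BalancedOnLevels v u
balancedOnLevels {r = zero} v u∉ zero    = dot-balanced (λ u≡0 → u∉ ((λ ()) , sym u≡0))
balancedOnLevels {n} {zero} v u∉ (suc k) = trans (card-empty {n} (λ _ → refl)) (sym (card-empty {n} (λ _ → refl)))
balancedOnLevels {r = suc r} v u∉       = balancedOnLevels-∷ v (balancedOnLevels (tail v)) u∉

level-count : ∀ {n r} (v : Fin r → F2 n) → LinIndep v → ∀ k → card (level v k) * 2 ^ r ≡ (r C k) * 2 ^ n
level-count {n} {zero} v _ zero    = trans (*-identityʳ _) (trans (card-full n) (sym (+-identityʳ _)))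
level-count {n} {zero} v _ (suc k) = cong (_* 1) (card-empty {n} (λ _ → refl))
level-count {n} {suc r} v li        = count
  where
  open ≡-Reasoning
  t = tail v
  ih : ∀ j → card (level t j) * 2 ^ r ≡ (r C j) * 2 ^ n
  ih = level-count t (LinIndep-tail v li)
  half : ∀ j a → 2 * card (λ y → level t j y ∧ lit a (dot (v zero) y)) ≡ card (level t j)
  half j = card-halves (level t j) (dot (v zero)) (balancedOnLevels t (head∉Span-tail v li) j)
  twice : ∀ a m → a * (2 * m) ≡ 2 * a * m
  twice = solve 2 (λ a m → a :* (con 2 :* m) := con 2 :* a :* m) refl
  count : ∀ k → card (level v k) * 2 ^ suc r ≡ (suc r C k) * 2 ^ n
  count zero = begin
    card (level v 0) * 2 ^ suc r  ≡⟨ cong (_* 2 ^ suc r) split ⟩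
    M * 2 ^ suc r                 ≡⟨ twice M (2 ^ r) ⟩
    2 * M * 2 ^ r                 ≡⟨ cong (_* 2 ^ r) (half 0 false) ⟩
    card (level t 0) * 2 ^ r      ≡⟨ ih 0 ⟩
    (r C 0) * 2 ^ n               ∎
    where
    M = card (λ y → level t 0 y ∧ not (dot (v zero) y))
    split : card (level v 0) ≡ M
    split = trans (card-split _ (dot (v zero))) (cong₂ _+_
      (trans (card-restrict _ true _ (λ _ → false) (level-hit-zero v)) (card-empty {n} (λ _ → refl)))
      (card-restrict _ false _ _ (level-miss v 0)))
  count (suc j) = begin
    card (level v (suc j)) * 2 ^ suc r                         ≡⟨ cong (_* 2 ^ suc r) split ⟩
    (H + M) * 2 ^ suc r                                        ≡⟨ twice (H + M) (2 ^ r) ⟩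
    2 * (H + M) * 2 ^ r                                        ≡⟨ cong (_* 2 ^ r) (*-distribˡ-+ 2 H M) ⟩
    (2 * H + 2 * M) * 2 ^ r                                    ≡⟨ cong₂ (λ a b → (a + b) * 2 ^ r) (half j true) (half (suc j) false) ⟩
    (card (level t j) + card (level t (suc j))) * 2 ^ r        ≡⟨ *-distribʳ-+ (2 ^ r) (card (level t j)) _ ⟩
    card (level t j) * 2 ^ r + card (level t (suc j)) * 2 ^ r  ≡⟨ cong₂ _+_ (ih j) (ih (suc j)) ⟩
    (r C j) * 2 ^ n + (r C suc j) * 2 ^ n                      ≡⟨ *-distribʳ-+ (2 ^ n) (r C j) (r C suc j) ⟨
    (r C j + r C suc j) * 2 ^ n                                ≡⟨ cong (_* 2 ^ n) (nCk+nC[k+1]≡[n+1]C[k+1] r j) ⟩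
    (suc r C suc j) * 2 ^ n                                    ∎
    where
    H = card (λ y → level t j y ∧ dot (v zero) y)
    M = card (λ y → level t (suc j) y ∧ not (dot (v zero) y))
    split : card (level v (suc j)) ≡ H + M
    split = trans (card-split _ (dot (v zero)))
      (cong₂ _+_ (card-restrict _ true _ _ (level-hit v j)) (card-restrict _ false _ _ (level-miss v (suc j))))

2^-cancel-≤ : ∀ {m n} → 2 ^ m ≤ 2 ^ n → m ≤ n
2^-cancel-≤ {m} {n} le = subst₂ _≤_ (⌊log₂[2^n]⌋≡n m) (⌊log₂[2^n]⌋≡n n) (⌊log₂⌋-mono-≤ le)

rank-bound : ∀ {n r} (v : Fin r → F2 n) → LinIndep v → r ≤ n
rank-bound {n} {r} v li = 2^-cancel-≤ (begin
  2 ^ r                     ≡⟨ *-identityˡ (2 ^ r) ⟨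
  1 * 2 ^ r                 ≤⟨ *-monoˡ-≤ (2 ^ r) (card-pos (level v 0) zeroV (cong (_≡ᵇ 0) (weight-zeroʳ v))) ⟩
  card (level v 0) * 2 ^ r  ≡⟨ level-count v li 0 ⟩
  1 * 2 ^ n                 ≡⟨ *-identityˡ (2 ^ n) ⟩
  2 ^ n                     ∎)
  where open ≤-Reasoning

level-card : ∀ {n r} (v : Fin r → F2 n) → LinIndep v → ∀ k → card (level v k) ≡ (r C k) * 2 ^ (n ∸ r)
level-card {n} {r} v li k = *-cancelʳ-≡ _ _ (2 ^ r) {{m^n≢0 2 r}} (begin
  card (level v k) * 2 ^ r         ≡⟨ level-count v li k ⟩
  (r C k) * 2 ^ n                  ≡⟨ cong (λ e → (r C k) * 2 ^ e) (m+[n∸m]≡n (rank-bound v li)) ⟨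
  (r C k) * 2 ^ (r + (n ∸ r))      ≡⟨ cong ((r C k) *_) (^-distribˡ-+-* 2 r (n ∸ r)) ⟩
  (r C k) * (2 ^ r * 2 ^ (n ∸ r))  ≡⟨ cong ((r C k) *_) (*-comm (2 ^ r) _) ⟩
  (r C k) * (2 ^ (n ∸ r) * 2 ^ r)  ≡⟨ *-assoc (r C k) _ _ ⟨
  (r C k) * 2 ^ (n ∸ r) * 2 ^ r    ∎)
  where open ≡-Reasoning

-- The set {0, v₁, …, v_r}

complement-half : ∀ {w h c k} → w + h ≡ c → c ≡ 2 * k → (2 * h ≡ c ⇔ w ≡ k)
complement-half {w} {h} {c} {k} w+h≡c c≡2k = mk⇔ to from
  where
  k+k≡c : k + k ≡ c
  k+k≡c = trans (cong (k +_) (sym (+-identityʳ k))) (sym c≡2k)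
  to : 2 * h ≡ c → w ≡ k
  to 2h≡c = +-cancelʳ-≡ k w k (trans (cong (w +_) (sym h≡k)) (trans w+h≡c (sym k+k≡c)))
    where
    h≡k : h ≡ k
    h≡k = *-cancelˡ-≡ h k 2 (trans 2h≡c c≡2k)
  from : w ≡ k → 2 * h ≡ c
  from w≡k = trans (cong (2 *_) h≡k) (sym c≡2k)
    where
    h≡k : h ≡ k
    h≡k = +-cancelˡ-≡ k h k (trans (cong (_+ h) (sym w≡k)) (trans w+h≡c (sym k+k≡c)))

balancingNumber≡0 : ∀ {n} (S : Subset n) → cardB S ≡ 0 → balancingNumber S ≡ 0ℚ
balancingNumber≡0 S B≡0 with cardC S
... | zero  = refl
... | suc c rewrite B≡0 = 0/n≡0 (suc c)

module ZeroAndIndependent {n r} {S : Subset n} (v : Fin r → F2 n) (li : LinIndep v)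
         (S⇔ : ∀ x → (S x ≡ true) ⇔ (x ≡ zeroV ⊎ ∃ λ i → x ≡ v i)) where

  private
    elements : List (F2 n)
    elements = zeroV ∷ tabulate v

    ∈elements⇔ : ∀ {x} → (x ≡ zeroV ⊎ ∃ λ i → x ≡ v i) ⇔ x ∈ elements
    ∈elements⇔ = mk⇔ (λ { (inj₁ x≡0) → here x≡0 ; (inj₂ (i , refl)) → there (∈-tabulate⁺ i) })
                     (λ { (here x≡0) → inj₁ x≡0 ; (there x∈v) → inj₂ (∈-tabulate⁻ x∈v) })

    S≡∈elements : ∀ x → S x ≡ does (x ∈? elements)
    S≡∈elements x = does-⇔ (⇔.trans Bool.T-≡ (⇔.trans (S⇔ x) ∈elements⇔)) (T? (S x)) (x ∈? elements)

    unique-elements : Unique elements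
    unique-elements =
      All.tabulate⁺ (λ i → LinIndep⇒nonzero v li i ∘ sym) ∷ Unique.tabulate⁺ (LinIndep⇒injective v li)

    card-S∩ : ∀ Q → card (λ x → S x ∧ Q x) ≡ countB Q elements
    card-S∩ Q = trans (card-cong (λ x → cong (_∧ Q x) (S≡∈elements x))) (card-∈ elements unique-elements Q)

  card-S : card S ≡ suc r
  card-S = begin
    card S                        ≡⟨ card-cong (λ x → sym (Bool.∧-identityʳ (S x))) ⟩
    card (λ x → S x ∧ true)       ≡⟨ card-S∩ _ ⟩
    countB (λ _ → true) elements  ≡⟨ countB-full elements ⟩
    suc (length (tabulate v))     ≡⟨ cong suc (length-tabulate v) ⟩
    suc r                         ∎
    where open ≡-Reasoning

  weight+cardH : ∀ y → weight v y + cardH S y ≡ card S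
  weight+cardH y = begin
    weight v y + cardH S y                                         ≡⟨ cong (_+ cardH S y) weight≡card ⟩
    card (λ x → S x ∧ dot x y) + card (λ x → S x ∧ not (dot x y))  ≡⟨ card-split S (λ x → dot x y) ⟨
    card S                                                         ∎
    where
    open ≡-Reasoning
    weight≡card : weight v y ≡ card (λ x → S x ∧ dot x y)
    weight≡card = sym (trans (card-S∩ _) (cong (λ b → if b then suc (weight v y) else weight v y) (dot-zeroˡ y)))

  isBalanced≡false : 2 ∣ r → ∀ y → isBalanced S y ≡ false
  isBalanced≡false 2∣r y = dec-false (2 * cardH S y ≟ℕ card S) (λ 2h≡S → 2≢1 (∣1⇒≡1 (2∣1 2h≡S)))
    where
    2≢1 : 2 ≢ 1
    2≢1 ()
    2∣1 : 2 * cardH S y ≡ card S → 2 ∣ 1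
    2∣1 2h≡S = ∣m+n∣m⇒∣n (subst (2 ∣_) (trans 2h≡S (trans card-S (+-comm 1 r))) (m∣m*n (cardH S y))) 2∣r

  isBalanced≡level : ∀ {k} → card S ≡ 2 * k → ∀ y → isBalanced S y ≡ level v k y
  isBalanced≡level {k} S≡2k y =
    does-⇔ (complement-half (weight+cardH y) S≡2k) (2 * cardH S y ≟ℕ card S) (weight v y ≟ℕ k)

  cardB≡card-level : ∀ {k} → card S ≡ 2 * k → cardB S ≡ card (level v k)
  cardB≡card-level {k} S≡2k = card-cong pointwise
    where
    open ≡-Reasoning
    0≢k : 0 ≢ k
    0≢k refl = 1+n≢0 (trans (sym card-S) S≡2k)
    pointwise : ∀ y → not (isZeroV y) ∧ isBalanced S y ≡ level v k y
    pointwise y with isZeroV y in y≟0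
    ... | false = isBalanced≡level S≡2k y
    ... | true  = sym (begin
      level v k y      ≡⟨ cong (level v k) (isZeroV-sound y≟0) ⟩
      level v k zeroV  ≡⟨ cong (_≡ᵇ k) (weight-zeroʳ v) ⟩
      0 ≡ᵇ k           ≡⟨ dec-false (0 ≟ℕ k) 0≢k ⟩
      false            ∎)

  cardB-even : 2 ∣ r → cardB S ≡ 0
  cardB-even 2∣r =
    card-empty (λ y → trans (cong (not (isZeroV y) ∧_) (isBalanced≡false 2∣r y)) (Bool.∧-zeroʳ _))

  cardB-odd : 2 ∣ card S → cardB S ≡ (r C ((r + 1) / 2)) * 2 ^ (n ∸ r)
  cardB-odd (divides k S≡k*2) = begin
    cardB S                            ≡⟨ cardB≡card-level (trans S≡k*2 (*-comm k 2)) ⟩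
    card (level v k)                   ≡⟨ level-card v li k ⟩
    (r C k) * 2 ^ (n ∸ r)              ≡⟨ cong (λ j → (r C j) * 2 ^ (n ∸ r)) k≡[r+1]/2 ⟩
    (r C ((r + 1) / 2)) * 2 ^ (n ∸ r)  ∎
    where
    open ≡-Reasoning
    k≡[r+1]/2 : k ≡ (r + 1) / 2
    k≡[r+1]/2 = sym (trans (cong (_/ 2) (trans (+-comm r 1) (trans (sym card-S) S≡k*2))) (m*n/n≡m k 2))

theorem4 : ∀ (n r : ℕ) (S : Subset n) (v : Fin r → F2 n) →
    LinIndep v →
    (∀ x → (S x ≡ true) ⇔ (x ≡ zeroV ⊎ ∃ λ i → x ≡ v i)) →
    ((2 ∣ card S) → ¬ (2 ∣ r) → cardB S ≡ (r C ((r + 1) / 2)) * 2 ^ (n ∸ r))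
    × ((2 ∣ r) → (cardB S ≡ 0) × (balancingNumber S ≡ 0ℚ))
theorem4 n r S v li S⇔ =
  (λ 2∣S _ → cardB-odd 2∣S) ,
  (λ 2∣r → cardB-even 2∣r , balancingNumber≡0 S (cardB-even 2∣r))
  where open ZeroAndIndependent v li S⇔
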